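{- Let $p\ge5$ be a prime and $m,n$ nonnegative integers. Then: (1) $D(m+1,n)+1\ge D(m,n)$, and $D(m,n)+1\ge D(m,n+c)$ for every $c\in\{1,\dots,p\}$; (2) if $m\ge\lfloor n/p\rfloor$, then $v_p\big(\binom{m}{m-\lfloor n/p\rfloor}\big)\ge D(m,n)$; (3) as polynomials in $z$, $\binom zm\binom zn=\sum_{j=\max\{m,n\}}^{m+n}\binom{j}{j-m,\,j-n,\,m+n-j}\binom zj$; (4) for nonnegative integers $s,t$ with $\max\{s,t\}\le m\le s+t$, $s-m+\lfloor\frac np\rfloor+\max\{t+v_p(\frac{t!}{n!}),0\}+v_p\big(\binom{m}{m-s,\,m-t,\,s+t-m}\big)\ge D(m,n)$.
   Context: For $m=m_0+pm_1+\cdots$ and $n=n_0+pn_1+\cdots$ the base-$p$ expansions ($m_i,n_i\in\{0,\dots,p-1\}$), $D(m,n)$ denotes the number of indices $i\ge0$ such that $n_{i+1}>m_i$. $\binom{j}{x,y,z}=\frac{j!}{x!y!z!}$ is the multinomial coefficient; $v_p(p)=1$. -}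

module Defs where

open import Data.Nat using (ℕ; zero; suc; _+_; _*_; _∸_; _<?_; _≟_; _⊔_; _!; _/_; _%_; NonZero)
open import Data.Nat.Properties using (_!≢0; m*n≢0)
open import Data.List using (List; length; filter; upTo; applyUpTo; foldr)
open import Data.Integer as ℤ using (ℤ; +_)
open import Data.Rational as ℚ using (ℚ)
open import Relation.Nullary using (yes; no)

-- ⌊ n / p ⌋ (junk value 0 for p = 0; only used with p prime)
infixl 7 _div_
_div_ : ℕ → ℕ → ℕ
n div zero = 0
n div p@(suc _) = n / p

digit : ℕ → ℕ → ℕ → ℕ
digit zero i n = 0
digit p@(suc _) zero n = n % p
digit p@(suc _) (suc i) n = digit p i (n / p)

-- D(m,n) = #{ i ≥ 0 : n_{i+1} > m_i }.
-- Indices i ≥ n never qualify (n_{i+1} ≠ 0 forces p^{i+1} ≤ n, so i < n),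
-- hence counting over i ∈ {0,…,n-1} counts all such i.
D : ℕ → ℕ → ℕ → ℕ
D p m n = length (filter (λ i → digit p i m <? digit p (suc i) n) (upTo n))

-- p-adic valuation of a natural number x ≠ 0 (number of times p divides x).
-- Fuel argument f (≥ x suffices). Junk value 0 for x = 0 or p < 2.
vpGo : (p : ℕ) → .{{NonZero p}} → ℕ → ℕ → ℕ
vpGo p zero x = 0
vpGo p (suc f) zero = 0
vpGo p (suc f) x@(suc _) with x % p ≟ 0
... | yes _ = suc (vpGo p f (x / p))
... | no _ = 0

vp : ℕ → ℕ → ℕ
vp zero x = 0
vp (suc zero) x = 0
vp p@(suc (suc _)) x = vpGo p x x

vpFactQuot : ℕ → ℕ → ℕ → ℤ
vpFactQuot p a b = (+ vp p (a !)) ℤ.- (+ vp p (b !))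

multinomial : ℕ → ℕ → ℕ → ℕ → ℕ
multinomial j x y z = (j !) / (x ! * y ! * z !)
  where instance
    _ = m*n≢0 (x ! * y !) (z !) {{m*n≢0 (x !) (y !) {{x !≢0}} {{y !≢0}}}} {{z !≢0}}

-- generalized binomial coefficient (z choose k) = z(z-1)…(z-k+1)/k!, as a
-- polynomial function of z evaluated on ℚ
falling : ℚ → ℕ → ℚ
falling z zero = ℚ.1ℚ
falling z (suc k) = falling z k ℚ.* (z ℚ.- (+ k ℚ./ 1))

binomQ : ℚ → ℕ → ℚ
binomQ z k = falling z k ℚ.* ((+ 1) ℚ./ (k !))
  where instance _ = k !≢0

sumℚ : List ℚ → ℚ
sumℚ = foldr ℚ._+_ ℚ.0ℚ

range : ℕ → ℕ → List ℕ
range a b = applyUpTo (λ k → a + k) (suc b ∸ a)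

{-# OPTIONS --safe #-}
module Submission where

-- D(m,n) counts the digit positions at which ⌊n/p⌋ exceeds m, so everything about D reduces to
-- a digit count exceed F x y = #{i < F : y_i < x_i}.  This count satisfies a triangle inequality in
-- its arguments and changes by at most one when one of them is incremented, which gives (1).  By
-- Legendre's formula v_p(x!) = ⌊x/p⌋ + v_p(⌊x/p⌋!), each position where a digit of x + y drops below
-- the digit of x is a carry and contributes to v_p((x+y)!) − v_p(x!) − v_p(y!) = v_p(C(x+y,x))
-- (the easy half of Kummer's theorem); with x = ⌊n/p⌋ and x + y = m this is (2).  For (4), the
-- triangle inequality along ⌊n/p⌋ → m−s → t → m bounds D(m,n) by exceed(⌊n/p⌋, m−s) plus the
-- valuations of C(t,m−s) and C(m,t), whose product is the multinomial coefficient; the remaining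
-- count is at most ⌊n/p⌋ − (m−s), or at most v_p(t!) − v_p(⌊n/p⌋!) when m−s ≥ ⌊n/p⌋.  Identity (3)
-- is (z)_m (z)_n = Σ_{k ≤ n} C(n,k) (m)_{n−k} (z)_{m+k}, proved by induction on n with Pascal's rule,
-- divided by m! n!.

open import Defs
open import Data.Nat using (ℕ; suc)
open import Data.Nat.Primality using (Prime)

module Factorials where
  open import Data.Nat
  open import Data.Nat.Properties
  open import Data.Nat.DivMod using (_/_; m/n*n≡m; m*n/n≡m; /-congˡ)
  open import Data.Nat.Combinatorics
    using (_C_; nCk≡n!/k![n-k]!; k![n∸k]!∣n!; [n-k]*[n-k-1]!≡[n-k]!)
  open import Data.Nat.Combinatorics.Base using (_P′_)
  open import Data.Nat.Tactic.RingSolver using (solve-∀)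
  open import Relation.Binary.PropositionalEquality
  open import Relation.Nullary using (contradiction)
  open ≡-Reasoning

  nCk*[k!*[n∸k]!]≡n! : ∀ {n k} → k ≤ n → (n C k) * (k ! * (n ∸ k) !) ≡ n !
  nCk*[k!*[n∸k]!]≡n! {n} {k} k≤n = begin
    (n C k) * (k ! * (n ∸ k) !)                 ≡⟨ cong (_* (k ! * (n ∸ k) !)) (nCk≡n!/k![n-k]! k≤n) ⟩
    n ! / (k ! * (n ∸ k) !) * (k ! * (n ∸ k) !) ≡⟨ m/n*n≡m (k![n∸k]!∣n! k≤n) ⟩
    n !                                         ∎
    where instance _ = k !* (n ∸ k) !≢0

  0<nCk : ∀ {n k} → k ≤ n → 0 < (n C k)
  0<nCk {n} {k} k≤n with (n C k) | nCk*[k!*[n∸k]!]≡n! k≤n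
  ... | zero  | 0≡n! = contradiction (sym 0≡n!) (≢-nonZero⁻¹ (n !) {{n !≢0}})
  ... | suc _ | _    = z<s

  nP′k*[n∸k]!≡n! : ∀ {n k} → k ≤ n → (n P′ k) * (n ∸ k) ! ≡ n !
  nP′k*[n∸k]!≡n! {n} {zero}  _   = *-identityˡ (n !)
  nP′k*[n∸k]!≡n! {n} {suc k} k<n = begin
    (n ∸ k) * (n P′ k) * (n ∸ suc k) !   ≡⟨ regroup (n ∸ k) (n P′ k) ((n ∸ suc k) !) ⟩
    (n P′ k) * ((n ∸ k) * (n ∸ suc k) !) ≡⟨ cong ((n P′ k) *_) ([n-k]*[n-k-1]!≡[n-k]! k<n) ⟩
    (n P′ k) * (n ∸ k) !                 ≡⟨ nP′k*[n∸k]!≡n! (<⇒≤ k<n) ⟩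
    n !                                  ∎
    where
    regroup : ∀ a b c → a * b * c ≡ b * (a * c)
    regroup = solve-∀

  module _ {n k j : ℕ} (k≤n : k ≤ n) (j≤k : j ≤ k) where

    nCk*kCj*factorials≡n! : (n C k) * (k C j) * (j ! * (n ∸ k) ! * (k ∸ j) !) ≡ n !
    nCk*kCj*factorials≡n! = begin
      (n C k) * (k C j) * (j ! * (n ∸ k) ! * (k ∸ j) !)   ≡⟨ regroup (n C k) (k C j) (j !) ((n ∸ k) !) ((k ∸ j) !) ⟩
      (n C k) * ((k C j) * (j ! * (k ∸ j) !) * (n ∸ k) !) ≡⟨ cong (λ x → (n C k) * (x * (n ∸ k) !)) (nCk*[k!*[n∸k]!]≡n! j≤k) ⟩
      (n C k) * (k ! * (n ∸ k) !)                         ≡⟨ nCk*[k!*[n∸k]!]≡n! k≤n ⟩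
      n !                                                 ∎
      where
      regroup : ∀ a b c d e → a * b * (c * d * e) ≡ a * (b * (c * e) * d)
      regroup = solve-∀

    multinomial≡nCk*kCj : multinomial n j (n ∸ k) (k ∸ j) ≡ (n C k) * (k C j)
    multinomial≡nCk*kCj = begin
      n ! / F                       ≡⟨ /-congˡ (sym nCk*kCj*factorials≡n!) ⟩
      (n C k) * (k C j) * F / F     ≡⟨ m*n/n≡m ((n C k) * (k C j)) F ⟩
      (n C k) * (k C j)             ∎
      where
      F = j ! * (n ∸ k) ! * (k ∸ j) !
      instance _ = m*n≢0 _ _ {{j !* (n ∸ k) !≢0}} {{(k ∸ j) !≢0}}

    multinomial*factorials≡n! : multinomial n j (n ∸ k) (k ∸ j) * (j ! * (n ∸ k) ! * (k ∸ j) !) ≡ n !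
    multinomial*factorials≡n! =
      trans (cong (_* (j ! * (n ∸ k) ! * (k ∸ j) !)) multinomial≡nCk*kCj) nCk*kCj*factorials≡n!

  nCk*mP′[n∸k]*[m+k]!≡multinomial*[m!*n!] : ∀ {m n k} → k ≤ n → n ∸ k ≤ m →
    (n C k) * (m P′ (n ∸ k)) * (m + k) ! ≡ multinomial (m + k) k (m + k ∸ n) (n ∸ k) * (m ! * n !)
  nCk*mP′[n∸k]*[m+k]!≡multinomial*[m!*n!] {m} {n} {k} k≤n d≤m = *-cancelʳ-≡ _ _ (k ! * r ! * d !) (begin
    (n C k) * (m P′ d) * j ! * (k ! * r ! * d !)       ≡⟨ regroup (n C k) (m P′ d) (j !) (k !) (r !) (d !) ⟩
    (n C k) * (k ! * d !) * ((m P′ d) * r !) * j !     ≡⟨ cong₂ (λ x y → x * y * j !) (nCk*[k!*[n∸k]!]≡n! k≤n) P′*r!≡m! ⟩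
    n ! * m ! * j !                                    ≡⟨ regroup′ (n !) (m !) (j !) ⟩
    j ! * (m ! * n !)                                  ≡⟨ cong (_* (m ! * n !)) (multinomial*factorials≡n! n≤j k≤n) ⟨
    M * (k ! * r ! * d !) * (m ! * n !)                ≡⟨ *-comm-middle M (k ! * r ! * d !) (m ! * n !) ⟩
    M * (m ! * n !) * (k ! * r ! * d !)                ∎)
    where
    j = m + k
    d = n ∸ k
    r = m + k ∸ n
    M = multinomial j k r d
    instance _ = m*n≢0 _ _ {{k !* r !≢0}} {{d !≢0}}
    n≤j : n ≤ j
    n≤j = subst (_≤ j) (m∸n+n≡m k≤n) (+-monoˡ-≤ k d≤m)
    r≡m∸d : r ≡ m ∸ d
    r≡m∸d = trans (cong₂ _∸_ (+-comm m k) (sym (m+[n∸m]≡n k≤n))) ([m+n]∸[m+o]≡n∸o k m d)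
    P′*r!≡m! : (m P′ d) * r ! ≡ m !
    P′*r!≡m! = trans (cong (λ x → (m P′ d) * x !) r≡m∸d) (nP′k*[n∸k]!≡n! d≤m)
    regroup : ∀ c q f a b e → c * q * f * (a * b * e) ≡ c * (a * e) * (q * b) * f
    regroup = solve-∀
    regroup′ : ∀ a b c → a * b * c ≡ c * (b * a)
    regroup′ = solve-∀
    *-comm-middle : ∀ a b c → a * b * c ≡ a * c * b
    *-comm-middle = solve-∀

module Digits (p-2 : ℕ) where
  open import Data.Nat
  open import Data.Nat.Properties
  open import Data.Nat.DivMod
  open import Data.Nat.Tactic.RingSolver using (solve-∀)
  open import Data.List using (List; length; filter; applyUpTo; upTo)
  open import Data.List.Properties using (filter-accept; filter-reject)
  open import Data.Product using (_×_; _,_)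
  open import Data.Sum using (_⊎_; inj₁; inj₂)
  open import Function using (_∘_; id)
  open import Relation.Binary.PropositionalEquality
  open import Relation.Nullary using (Dec; yes; no; ¬_; contradiction)
  open import Relation.Unary using (Decidable)

  p : ℕ
  p = suc (suc p-2)

  1<p : 1 < p
  1<p = s<s z<s

  n/p<n : ∀ n → .{{NonZero n}} → n / p < n
  n/p<n n = m/n<m n p 1<p

  [r+q*p]%p≡r : ∀ {r} q → r < p → (r + q * p) % p ≡ r
  [r+q*p]%p≡r {r} q r<p = trans ([m+kn]%n≡m%n r q p) (m<n⇒m%n≡m r<p)

  [r+q*p]/p≡q : ∀ {r} q → r < p → (r + q * p) / p ≡ q
  [r+q*p]/p≡q {r} q r<p = trans (+-distrib-/-∣ʳ r (divides-refl q)) (cong₂ _+_ (m<n⇒m/n≡0 r<p) (m*n/n≡m q p))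
    where open import Data.Nat.Divisibility using (divides-refl)

  suc-carry : ∀ n → suc n / p ≡ n / p ⊎ (suc n % p ≡ 0 × suc n / p ≡ suc (n / p))
  suc-carry n with suc (n % p) <? p
  ... | yes 1+n%p<p = inj₁ (trans (cong (_/ p) (cong suc (m≡m%n+[m/n]*n n p))) ([r+q*p]/p≡q (n / p) 1+n%p<p))
  ... | no  1+n%p≮p = inj₂ ( trans (cong (_% p) 1+n≡) ([r+q*p]%p≡r (suc (n / p)) z<s)
                           , trans (cong (_/ p) 1+n≡) ([r+q*p]/p≡q (suc (n / p)) z<s))
    where
    1+n≡ : suc n ≡ 0 + suc (n / p) * p
    1+n≡ = begin
      suc n                     ≡⟨ cong suc (m≡m%n+[m/n]*n n p) ⟩
      suc (n % p) + n / p * p   ≡⟨ cong (_+ n / p * p) (≤-antisym (m%n<n n p) (≮⇒≥ 1+n%p≮p)) ⟩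
      p + n / p * p             ∎
      where open ≡-Reasoning

  x+y≡[x%p+y%p]+[x/p+y/p]*p : ∀ x y → x + y ≡ (x % p + y % p) + (x / p + y / p) * p
  x+y≡[x%p+y%p]+[x/p+y/p]*p x y =
    trans (cong₂ _+_ (m≡m%n+[m/n]*n x p) (m≡m%n+[m/n]*n y p)) (regroup (x % p) (y % p) (x / p) (y / p) p)
    where
    regroup : ∀ a b c d p → (a + c * p) + (b + d * p) ≡ (a + b) + (c + d) * p
    regroup = solve-∀

  +-carry : ∀ x y → (x % p ≤ (x + y) % p × (x + y) / p ≡ x / p + y / p)
                  ⊎ ((x + y) % p < x % p × (x + y) / p ≡ suc (x / p + y / p))
  +-carry x y with x % p + y % p <? p
  ... | yes no-carry = inj₁
    ( subst (x % p ≤_) (sym (trans (cong (_% p) x+y≡) ([r+q*p]%p≡r (x / p + y / p) no-carry))) (m≤m+n (x % p) (y % p))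
    , trans (cong (_/ p) x+y≡) ([r+q*p]/p≡q (x / p + y / p) no-carry))
    where x+y≡ = x+y≡[x%p+y%p]+[x/p+y/p]*p x y
  ... | no carry = inj₂
    ( subst (_< x % p) (sym (trans (cong (_% p) x+y≡) ([r+q*p]%p≡r (suc (x / p + y / p)) r<p))) r<x%p
    , trans (cong (_/ p) x+y≡) ([r+q*p]/p≡q (suc (x / p + y / p)) r<p))
    where
    r = x % p + y % p ∸ p
    x%p+y%p≡p+r : x % p + y % p ≡ p + r
    x%p+y%p≡p+r = sym (m+[n∸m]≡n (≮⇒≥ carry))
    r<x%p : r < x % p
    r<x%p = +-cancelʳ-< p r (x % p)
      (subst (_< x % p + p) (trans x%p+y%p≡p+r (+-comm p r)) (+-monoʳ-< (x % p) (m%n<n y p)))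
    r<p : r < p
    r<p = <-≤-trans r<x%p (<⇒≤ (m%n<n x p))
    x+y≡ : x + y ≡ r + suc (x / p + y / p) * p
    x+y≡ = trans (x+y≡[x%p+y%p]+[x/p+y/p]*p x y)
                 (trans (cong (_+ (x / p + y / p) * p) x%p+y%p≡p+r) (carry-out p r (x / p + y / p)))
      where
      carry-out : ∀ p r q → (p + r) + q * p ≡ r + suc q * p
      carry-out = solve-∀

  n≤1+m⇒n/p≤m : ∀ {n m} → n ≤ suc m → n / p ≤ m
  n≤1+m⇒n/p≤m {zero}    _      = z≤n
  n≤1+m⇒n/p≤m {n@(suc _)} n≤1+m = ≤-pred (<-≤-trans (n/p<n n) n≤1+m)

  digit<? : ∀ x y → Decidable (λ i → digit p i y < digit p i x)
  digit<? x y i = digit p i y <? digit p i x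

  exceed : ℕ → ℕ → ℕ → ℕ
  exceed zero    x y = 0
  exceed (suc F) x y with y % p <? x % p
  ... | yes _ = suc (exceed F (x / p) (y / p))
  ... | no  _ = exceed F (x / p) (y / p)

  count-digit< : ℕ → ℕ → List ℕ → ℕ
  count-digit< x y = length ∘ filter (digit<? x y)

  count-digit<-shift : ∀ F (f : ℕ → ℕ) x y →
    count-digit< x y (applyUpTo (suc ∘ f) F) ≡ count-digit< (x / p) (y / p) (applyUpTo f F)
  count-digit<-shift zero    f x y = refl
  count-digit<-shift (suc F) f x y with digit<? (x / p) (y / p) (f 0)
  ... | yes y₀<x₀ = begin
    count-digit< x y (applyUpTo (suc ∘ f) (suc F))
      ≡⟨ cong length (filter-accept (digit<? x y) {x = suc (f 0)} {xs = applyUpTo (suc ∘ f ∘ suc) F} y₀<x₀) ⟩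
    suc (count-digit< x y (applyUpTo (suc ∘ f ∘ suc) F))
      ≡⟨ cong suc (count-digit<-shift F (f ∘ suc) x y) ⟩
    suc (count-digit< (x / p) (y / p) (applyUpTo (f ∘ suc) F))
      ≡⟨ cong length (filter-accept (digit<? (x / p) (y / p)) {x = f 0} {xs = applyUpTo (f ∘ suc) F} y₀<x₀) ⟨
    count-digit< (x / p) (y / p) (applyUpTo f (suc F)) ∎
    where open ≡-Reasoning
  ... | no y₀≮x₀ = begin
    count-digit< x y (applyUpTo (suc ∘ f) (suc F))
      ≡⟨ cong length (filter-reject (digit<? x y) {x = suc (f 0)} {xs = applyUpTo (suc ∘ f ∘ suc) F} y₀≮x₀) ⟩
    count-digit< x y (applyUpTo (suc ∘ f ∘ suc) F)
      ≡⟨ count-digit<-shift F (f ∘ suc) x y ⟩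
    count-digit< (x / p) (y / p) (applyUpTo (f ∘ suc) F)
      ≡⟨ cong length (filter-reject (digit<? (x / p) (y / p)) {x = f 0} {xs = applyUpTo (f ∘ suc) F} y₀≮x₀) ⟨
    count-digit< (x / p) (y / p) (applyUpTo f (suc F)) ∎
    where open ≡-Reasoning

  count-digit<-upTo≡exceed : ∀ F x y → count-digit< x y (upTo F) ≡ exceed F x y
  count-digit<-upTo≡exceed zero    x y = refl
  count-digit<-upTo≡exceed (suc F) x y with y % p <? x % p
  ... | yes y₀<x₀ = trans (cong length (filter-accept (digit<? x y) {x = 0} {xs = applyUpTo suc F} y₀<x₀))
                          (cong suc (trans (count-digit<-shift F id x y) (count-digit<-upTo≡exceed F (x / p) (y / p))))
  ... | no y₀≮x₀  = trans (cong length (filter-reject (digit<? x y) {x = 0} {xs = applyUpTo suc F} y₀≮x₀))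
                          (trans (count-digit<-shift F id x y) (count-digit<-upTo≡exceed F (x / p) (y / p)))

  D≡exceed : ∀ m n → D p m n ≡ exceed n (n / p) m
  D≡exceed m n = count-digit<-upTo≡exceed n (n / p) m

  exceed-yes : ∀ F x y → y % p < x % p → exceed (suc F) x y ≡ suc (exceed F (x / p) (y / p))
  exceed-yes F x y y₀<x₀ with y % p <? x % p
  ... | yes _      = refl
  ... | no  y₀≮x₀  = contradiction y₀<x₀ y₀≮x₀

  exceed-no : ∀ F x y → ¬ y % p < x % p → exceed (suc F) x y ≡ exceed F (x / p) (y / p)
  exceed-no F x y y₀≮x₀ with y % p <? x % p
  ... | yes y₀<x₀ = contradiction y₀<x₀ y₀≮x₀
  ... | no  _     = refl

  exceed-suc-≤ : ∀ F x y → exceed (suc F) x y ≤ suc (exceed F (x / p) (y / p))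
  exceed-suc-≤ F x y with y % p <? x % p
  ... | yes _ = ≤-refl
  ... | no  _ = n≤1+n _

  exceed-suc-≥ : ∀ F x y → exceed F (x / p) (y / p) ≤ exceed (suc F) x y
  exceed-suc-≥ F x y with y % p <? x % p
  ... | yes _ = n≤1+n _
  ... | no  _ = ≤-refl

  exceed-zeroˡ : ∀ F y → exceed F 0 y ≡ 0
  exceed-zeroˡ zero    y = refl
  exceed-zeroˡ (suc F) y = trans (exceed-no F 0 y λ ()) (exceed-zeroˡ F (y / p))

  exceed-extend : ∀ F k {x} y → x ≤ F → exceed (F + k) x y ≡ exceed F x y
  exceed-extend zero    k y z≤n = exceed-zeroˡ k y
  exceed-extend (suc F) k {x} y x≤1+F with y % p <? x % p
  ... | yes _ = cong suc (exceed-extend F k (y / p) (n≤1+m⇒n/p≤m x≤1+F))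
  ... | no  _ = exceed-extend F k (y / p) (n≤1+m⇒n/p≤m x≤1+F)

  exceed-sucʳ : ∀ F x y → exceed F x y ≤ suc (exceed F x (suc y))
  exceed-sucʳ zero    x y = z≤n
  exceed-sucʳ (suc F) x y with suc-carry y
  ... | inj₁ 1+y/p≡y/p = begin
    exceed (suc F) x y                   ≤⟨ exceed-suc-≤ F x y ⟩
    suc (exceed F (x / p) (y / p))       ≡⟨ cong (suc ∘ exceed F (x / p)) 1+y/p≡y/p ⟨
    suc (exceed F (x / p) (suc y / p))   ≤⟨ s≤s (exceed-suc-≥ F x (suc y)) ⟩
    suc (exceed (suc F) x (suc y))       ∎
    where open ≤-Reasoning
  ... | inj₂ (1+y%p≡0 , 1+y/p≡) = begin
    exceed (suc F) x y                   ≡⟨ exceed-no F x y y₀≮x₀ ⟩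
    exceed F (x / p) (y / p)             ≤⟨ exceed-sucʳ F (x / p) (y / p) ⟩
    suc (exceed F (x / p) (suc (y / p))) ≡⟨ cong (suc ∘ exceed F (x / p)) 1+y/p≡ ⟨
    suc (exceed F (x / p) (suc y / p))   ≤⟨ s≤s (exceed-suc-≥ F x (suc y)) ⟩
    suc (exceed (suc F) x (suc y))       ∎
    where
    open ≤-Reasoning
    y₀≮x₀ : ¬ y % p < x % p
    y₀≮x₀ y₀<x₀ = <⇒≱ (m%n<n x p) (subst (λ r → suc r ≤ x % p) (%-pred-≡0 {y} {p} 1+y%p≡0) y₀<x₀)

  exceed-sucˡ : ∀ F x y → exceed F (suc x) y ≤ suc (exceed F x y)
  exceed-sucˡ zero    x y = z≤n
  exceed-sucˡ (suc F) x y with suc-carry x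
  ... | inj₁ 1+x/p≡x/p = begin
    exceed (suc F) (suc x) y             ≤⟨ exceed-suc-≤ F (suc x) y ⟩
    suc (exceed F (suc x / p) (y / p))   ≡⟨ cong (λ z → suc (exceed F z (y / p))) 1+x/p≡x/p ⟩
    suc (exceed F (x / p) (y / p))       ≤⟨ s≤s (exceed-suc-≥ F x y) ⟩
    suc (exceed (suc F) x y)             ∎
    where open ≤-Reasoning
  ... | inj₂ (1+x%p≡0 , 1+x/p≡) = begin
    exceed (suc F) (suc x) y             ≡⟨ exceed-no F (suc x) y (λ y₀<x₀ → n≮0 (subst (y % p <_) 1+x%p≡0 y₀<x₀)) ⟩
    exceed F (suc x / p) (y / p)         ≡⟨ cong (λ z → exceed F z (y / p)) 1+x/p≡ ⟩
    exceed F (suc (x / p)) (y / p)       ≤⟨ exceed-sucˡ F (x / p) (y / p) ⟩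
    suc (exceed F (x / p) (y / p))       ≤⟨ s≤s (exceed-suc-≥ F x y) ⟩
    suc (exceed (suc F) x y)             ∎
    where open ≤-Reasoning

  exceed-triangle : ∀ F x y z → exceed F x z ≤ exceed F x y + exceed F y z
  exceed-triangle zero    x y z = z≤n
  exceed-triangle (suc F) x y z = by-digits (z % p <? x % p) (z % p <? y % p)
    where
    open ≤-Reasoning
    by-digits : Dec (z % p < x % p) → Dec (z % p < y % p) → exceed (suc F) x z ≤ exceed (suc F) x y + exceed (suc F) y z
    by-digits (no z₀≮x₀) _ = begin
      exceed (suc F) x z                                        ≡⟨ exceed-no F x z z₀≮x₀ ⟩
      exceed F (x / p) (z / p)                                  ≤⟨ exceed-triangle F (x / p) (y / p) (z / p) ⟩
      exceed F (x / p) (y / p) + exceed F (y / p) (z / p)       ≤⟨ +-mono-≤ (exceed-suc-≥ F x y) (exceed-suc-≥ F y z) ⟩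
      exceed (suc F) x y + exceed (suc F) y z                   ∎
    by-digits (yes z₀<x₀) (yes z₀<y₀) = begin
      exceed (suc F) x z                                        ≡⟨ exceed-yes F x z z₀<x₀ ⟩
      suc (exceed F (x / p) (z / p))                            ≤⟨ s≤s (exceed-triangle F (x / p) (y / p) (z / p)) ⟩
      suc (exceed F (x / p) (y / p) + exceed F (y / p) (z / p)) ≡⟨ +-suc _ _ ⟨
      exceed F (x / p) (y / p) + suc (exceed F (y / p) (z / p)) ≤⟨ +-mono-≤ (exceed-suc-≥ F x y) (≤-reflexive (sym (exceed-yes F y z z₀<y₀))) ⟩
      exceed (suc F) x y + exceed (suc F) y z                   ∎
    by-digits (yes z₀<x₀) (no z₀≮y₀) = begin
      exceed (suc F) x z                                        ≡⟨ exceed-yes F x z z₀<x₀ ⟩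
      suc (exceed F (x / p) (z / p))                            ≤⟨ s≤s (exceed-triangle F (x / p) (y / p) (z / p)) ⟩
      suc (exceed F (x / p) (y / p) + exceed F (y / p) (z / p)) ≤⟨ +-mono-≤ (≤-reflexive (sym (exceed-yes F x y y₀<x₀))) (exceed-suc-≥ F y z) ⟩
      exceed (suc F) x y + exceed (suc F) y z                   ∎
      where
      y₀<x₀ : y % p < x % p
      y₀<x₀ = ≤-<-trans (≮⇒≥ z₀≮y₀) z₀<x₀

  1+e+r≤[1+e]*p : ∀ e {r} → r < p → suc e + r ≤ suc e * p
  1+e+r≤[1+e]*p e {r} r<p = subst (_≤ suc e * p) (cong suc (+-comm r e)) (+-mono-≤ r<p (m≤m*n e p))

  exceed+y≤x : ∀ F {x y} → y ≤ x → exceed F x y + y ≤ x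
  exceed+y≤x zero    y≤x = y≤x
  exceed+y≤x (suc F) {x} {y} y≤x = by-digit (y % p <? x % p)
    where
    open ≤-Reasoning
    e = exceed F (x / p) (y / p)
    e+y/p≤x/p : e + y / p ≤ x / p
    e+y/p≤x/p = exceed+y≤x F (/-monoˡ-≤ p y≤x)
    by-digit : Dec (y % p < x % p) → exceed (suc F) x y + y ≤ x
    by-digit (yes y₀<x₀) = begin
      exceed (suc F) x y + y          ≡⟨ cong₂ _+_ (exceed-yes F x y y₀<x₀) (m≡m%n+[m/n]*n y p) ⟩
      suc e + (y % p + y / p * p)     ≡⟨ regroup e (y % p) (y / p * p) ⟩
      suc (y % p) + (e + y / p * p)   ≤⟨ +-mono-≤ y₀<x₀ (+-monoˡ-≤ (y / p * p) (m≤m*n e p)) ⟩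
      x % p + (e * p + y / p * p)     ≡⟨ cong (x % p +_) (*-distribʳ-+ p e (y / p)) ⟨
      x % p + (e + y / p) * p         ≤⟨ +-monoʳ-≤ (x % p) (*-monoˡ-≤ p e+y/p≤x/p) ⟩
      x % p + x / p * p               ≡⟨ m≡m%n+[m/n]*n x p ⟨
      x                               ∎
      where
      regroup : ∀ e a b → suc e + (a + b) ≡ suc a + (e + b)
      regroup = solve-∀
    by-digit (no y₀≮x₀) = subst (λ n → n + y ≤ x) (sym (exceed-no F x y y₀≮x₀)) (from-quotients e e+y/p≤x/p)
      where
      from-quotients : ∀ e → e + y / p ≤ x / p → e + y ≤ x
      from-quotients zero    _           = y≤x
      from-quotients (suc e) 1+e+y/p≤x/p = begin
        suc e + y                     ≡⟨ cong (suc e +_) (m≡m%n+[m/n]*n y p) ⟩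
        suc e + (y % p + y / p * p)   ≡⟨ +-assoc (suc e) (y % p) _ ⟨
        suc e + y % p + y / p * p     ≤⟨ +-monoˡ-≤ (y / p * p) (1+e+r≤[1+e]*p e (m%n<n y p)) ⟩
        suc e * p + y / p * p         ≡⟨ *-distribʳ-+ p (suc e) (y / p) ⟨
        (suc e + y / p) * p           ≤⟨ *-monoˡ-≤ p 1+e+y/p≤x/p ⟩
        x / p * p                     ≤⟨ m/n*n≤m x p ⟩
        x                             ∎

  D-suc-≤ : ∀ m n → D p m n ≤ D p (suc m) n + 1
  D-suc-≤ m n = begin
    D p m n                           ≡⟨ D≡exceed m n ⟩
    exceed n (n / p) m                ≤⟨ exceed-sucʳ n (n / p) m ⟩
    suc (exceed n (n / p) (suc m))    ≡⟨ cong suc (D≡exceed (suc m) n) ⟨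
    suc (D p (suc m) n)               ≡⟨ +-comm 1 (D p (suc m) n) ⟩
    D p (suc m) n + 1                 ∎
    where open ≤-Reasoning

  [n+c]/p≤1+n/p : ∀ n {c} → c ≤ p → (n + c) / p ≤ suc (n / p)
  [n+c]/p≤1+n/p n {c} c≤p = begin
    (n + c) / p               ≤⟨ /-monoˡ-≤ p (+-monoʳ-≤ n c≤p) ⟩
    (n + p) / p               ≡⟨ m/n≡1+[m∸n]/n (m≤n+m p n) ⟩
    suc ((n + p ∸ p) / p)     ≡⟨ cong (λ z → suc (z / p)) (m+n∸n≡m n p) ⟩
    suc (n / p)               ∎
    where open ≤-Reasoning

  D-+-≤ : ∀ m n {c} → c ≤ p → D p m (n + c) ≤ D p m n + 1
  D-+-≤ m n {c} c≤p = begin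
    D p m (n + c)                     ≡⟨ D≡exceed m (n + c) ⟩
    exceed (n + c) ((n + c) / p) m    ≤⟨ exceed-at-most-one-more ⟩
    suc (exceed (n + c) (n / p) m)    ≡⟨ cong suc (exceed-extend n c m (m/n≤m n p)) ⟩
    suc (exceed n (n / p) m)          ≡⟨ cong suc (D≡exceed m n) ⟨
    suc (D p m n)                     ≡⟨ +-comm 1 (D p m n) ⟩
    D p m n + 1                       ∎
    where
    open ≤-Reasoning
    exceed-at-most-one-more : exceed (n + c) ((n + c) / p) m ≤ suc (exceed (n + c) (n / p) m)
    exceed-at-most-one-more with m≤n⇒m<n∨m≡n (/-monoˡ-≤ p (m≤m+n n c))
    ... | inj₂ n/p≡[n+c]/p = subst (λ z → exceed (n + c) z m ≤ suc (exceed (n + c) (n / p) m)) n/p≡[n+c]/p (n≤1+n _)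
    ... | inj₁ n/p<[n+c]/p = subst (λ z → exceed (n + c) z m ≤ suc (exceed (n + c) (n / p) m))
                               (≤-antisym n/p<[n+c]/p ([n+c]/p≤1+n/p n c≤p)) (exceed-sucˡ (n + c) (n / p) m)

module Valuation (p-2 : ℕ) (p-prime : Prime (suc (suc p-2))) where
  open import Data.Nat
  open import Data.Nat.Properties
  open import Data.Nat.DivMod
  open import Data.Nat.Divisibility using (m%n≡0⇒n∣m; n∣m⇒m%n≡0; ∣⇒≤)
  open import Data.Nat.Primality using (euclidsLemma)
  open import Data.Nat.Combinatorics using (_C_; nCk≡nC[n∸k])
  open import Data.Nat.Tactic.RingSolver using (solve-∀)
  open import Data.Product using (_,_)
  open import Data.Sum using (inj₁; inj₂)
  open import Function using (_∘_)
  open import Relation.Binary.PropositionalEquality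
  open import Relation.Nullary using (yes; no; contradiction)
  open Digits p-2
  open Factorials

  vpGo-fuel-irrelevant : ∀ f g x → x ≤ f → x ≤ g → vpGo p f x ≡ vpGo p g x
  vpGo-fuel-irrelevant zero    zero    zero    _ _ = refl
  vpGo-fuel-irrelevant zero    (suc g) zero    _ _ = refl
  vpGo-fuel-irrelevant (suc f) zero    zero    _ _ = refl
  vpGo-fuel-irrelevant (suc f) (suc g) zero    _ _ = refl
  vpGo-fuel-irrelevant (suc f) (suc g) x@(suc _) x≤1+f x≤1+g with x % p ≟ 0
  ... | yes _ = cong suc (vpGo-fuel-irrelevant f g (x / p) (n≤1+m⇒n/p≤m x≤1+f) (n≤1+m⇒n/p≤m x≤1+g))
  ... | no  _ = refl

  vp-∤ : ∀ x → x % p ≢ 0 → vp p x ≡ 0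
  vp-∤ zero        x%p≢0 = contradiction refl x%p≢0
  vp-∤ x@(suc _)   x%p≢0 with x % p ≟ 0
  ... | yes x%p≡0 = contradiction x%p≡0 x%p≢0
  ... | no  _     = refl

  vp-∣ : ∀ x → .{{NonZero x}} → x % p ≡ 0 → vp p x ≡ suc (vp p (x / p))
  vp-∣ x@(suc x-1) x%p≡0 with x % p ≟ 0
  ... | yes _     = cong suc (vpGo-fuel-irrelevant x-1 (x / p) (x / p) (≤-pred (n/p<n x)) ≤-refl)
  ... | no  x%p≢0 = contradiction x%p≡0 x%p≢0

  vp-*p : ∀ x → .{{NonZero x}} → vp p (x * p) ≡ suc (vp p x)
  vp-*p x = trans (vp-∣ (x * p) {{m*n≢0 x p}} (m*n%n≡0 x p)) (cong (suc ∘ vp p) (m*n/n≡m x p))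

  x/p≢0 : ∀ x → .{{NonZero x}} → x % p ≡ 0 → NonZero (x / p)
  x/p≢0 x x%p≡0 = >-nonZero (m≥n⇒m/n>0 (∣⇒≤ (m%n≡0⇒n∣m x p x%p≡0)))

  vp-* : ∀ x y → .{{NonZero x}} → .{{NonZero y}} → vp p (x * y) ≡ vp p x + vp p y
  vp-* x y = bounded (x + y) x y ≤-refl
    where
    bounded : ∀ F x y → .{{NonZero x}} → .{{NonZero y}} → x + y ≤ F → vp p (x * y) ≡ vp p x + vp p y
    p∣x : ∀ F x y → .{{NonZero x}} → .{{NonZero y}} → x + y ≤ suc F → x % p ≡ 0 → vp p (x * y) ≡ vp p x + vp p y

    bounded zero    (suc _) _ ()
    bounded (suc F) x y x+y≤1+F with x % p ≟ 0 | y % p ≟ 0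
    ... | yes x%p≡0 | _         = p∣x F x y x+y≤1+F x%p≡0
    ... | no  _     | yes y%p≡0 = begin
      vp p (x * y)     ≡⟨ cong (vp p) (*-comm x y) ⟩
      vp p (y * x)     ≡⟨ p∣x F y x (subst (_≤ suc F) (+-comm x y) x+y≤1+F) y%p≡0 ⟩
      vp p y + vp p x  ≡⟨ +-comm (vp p y) (vp p x) ⟩
      vp p x + vp p y  ∎
      where open ≡-Reasoning
    ... | no x%p≢0 | no y%p≢0 = trans (vp-∤ (x * y) xy%p≢0) (sym (cong₂ _+_ (vp-∤ x x%p≢0) (vp-∤ y y%p≢0)))
      where
      xy%p≢0 : (x * y) % p ≢ 0
      xy%p≢0 xy%p≡0 with euclidsLemma x y p-prime (m%n≡0⇒n∣m (x * y) p xy%p≡0)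
      ... | inj₁ p∣x = x%p≢0 (n∣m⇒m%n≡0 x p p∣x)
      ... | inj₂ p∣y = y%p≢0 (n∣m⇒m%n≡0 y p p∣y)

    p∣x F x y x+y≤1+F x%p≡0 = begin
      vp p (x * y)            ≡⟨ cong (λ z → vp p (z * y)) (m/n*n≡m (m%n≡0⇒n∣m x p x%p≡0)) ⟨
      vp p (x′ * p * y)       ≡⟨ cong (vp p) (*-comm-middle x′ p y) ⟩
      vp p (x′ * y * p)       ≡⟨ vp-*p (x′ * y) {{m*n≢0 x′ y}} ⟩
      suc (vp p (x′ * y))     ≡⟨ cong suc (bounded F x′ y (≤-pred (<-≤-trans (+-monoˡ-< y (n/p<n x)) x+y≤1+F))) ⟩
      suc (vp p x′ + vp p y)  ≡⟨ cong (_+ vp p y) (vp-∣ x x%p≡0) ⟨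
      vp p x + vp p y         ∎
      where
      open ≡-Reasoning
      x′ = x / p
      instance _ = x/p≢0 x x%p≡0
      *-comm-middle : ∀ a b c → a * b * c ≡ a * c * b
      *-comm-middle = solve-∀

  vp! : ℕ → ℕ
  vp! n = vp p (n !)

  vp!-suc : ∀ n → vp! (suc n) ≡ vp p (suc n) + vp! n
  vp!-suc n = vp-* (suc n) (n !) {{_}} {{n !≢0}}

  vp!≤vp!-suc : ∀ n → vp! n ≤ vp! (suc n)
  vp!≤vp!-suc n = subst (vp! n ≤_) (sym (vp!-suc n)) (m≤n+m (vp! n) (vp p (suc n)))

  vp!-mono-≤ : ∀ {m n} → m ≤ n → vp! m ≤ vp! n
  vp!-mono-≤ {n = zero}  z≤n = ≤-refl
  vp!-mono-≤ {m} {suc n} m≤1+n with m≤n⇒m<n∨m≡n m≤1+n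
  ... | inj₁ m<1+n = ≤-trans (vp!-mono-≤ (≤-pred m<1+n)) (vp!≤vp!-suc n)
  ... | inj₂ refl  = ≤-refl

  vp![r+q*p]≡vp![q*p] : ∀ {r} q → r < p → vp! (r + q * p) ≡ vp! (q * p)
  vp![r+q*p]≡vp![q*p] {zero}  q _     = refl
  vp![r+q*p]≡vp![q*p] {suc r} q 1+r<p = begin
    vp! (suc r + q * p)                         ≡⟨ vp!-suc (r + q * p) ⟩
    vp p (suc r + q * p) + vp! (r + q * p)      ≡⟨ cong (_+ vp! (r + q * p)) (vp-∤ (suc r + q * p) p∤) ⟩
    vp! (r + q * p)                             ≡⟨ vp![r+q*p]≡vp![q*p] q (<-trans (n<1+n r) 1+r<p) ⟩
    vp! (q * p)                                 ∎
    where
    open ≡-Reasoning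
    p∤ : (suc r + q * p) % p ≢ 0
    p∤ = 1+n≢0 ∘ trans (sym ([r+q*p]%p≡r q 1+r<p))

  vp![q*p]≡q+vp!q : ∀ q → vp! (q * p) ≡ q + vp! q
  vp![q*p]≡q+vp!q zero    = refl
  vp![q*p]≡q+vp!q (suc q) = begin
    vp! (suc q * p)                               ≡⟨ vp!-suc (suc p-2 + q * p) ⟩
    vp p (suc q * p) + vp! (suc p-2 + q * p)      ≡⟨ cong₂ _+_ (vp-*p (suc q)) (vp![r+q*p]≡vp![q*p] q ≤-refl) ⟩
    suc (vp p (suc q)) + vp! (q * p)              ≡⟨ cong (suc (vp p (suc q)) +_) (vp![q*p]≡q+vp!q q) ⟩
    suc (vp p (suc q)) + (q + vp! q)              ≡⟨ cong suc (x+[y+z]≡y+[x+z] (vp p (suc q)) q (vp! q)) ⟩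
    suc q + (vp p (suc q) + vp! q)                ≡⟨ cong (suc q +_) (vp!-suc q) ⟨
    suc q + vp! (suc q)                           ∎
    where
    open ≡-Reasoning
    x+[y+z]≡y+[x+z] : ∀ x y z → x + (y + z) ≡ y + (x + z)
    x+[y+z]≡y+[x+z] = solve-∀

  legendre : ∀ n → vp! n ≡ n / p + vp! (n / p)
  legendre n = begin
    vp! n                       ≡⟨ cong vp! (m≡m%n+[m/n]*n n p) ⟩
    vp! (n % p + n / p * p)     ≡⟨ vp![r+q*p]≡vp![q*p] (n / p) (m%n<n n p) ⟩
    vp! (n / p * p)             ≡⟨ vp![q*p]≡q+vp!q (n / p) ⟩
    n / p + vp! (n / p)         ∎
    where open ≡-Reasoning

  vp-nCk+vp!k+vp![n∸k]≡vp!n : ∀ {n k} → k ≤ n → vp p (n C k) + (vp! k + vp! (n ∸ k)) ≡ vp! n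
  vp-nCk+vp!k+vp![n∸k]≡vp!n {n} {k} k≤n = begin
    vp p (n C k) + (vp! k + vp! (n ∸ k))   ≡⟨ cong (vp p (n C k) +_) (vp-* (k !) ((n ∸ k) !) {{k !≢0}} {{(n ∸ k) !≢0}}) ⟨
    vp p (n C k) + vp p (k ! * (n ∸ k) !)  ≡⟨ vp-* (n C k) (k ! * (n ∸ k) !) {{>-nonZero (0<nCk k≤n)}} {{k !* (n ∸ k) !≢0}} ⟨
    vp p ((n C k) * (k ! * (n ∸ k) !))     ≡⟨ cong (vp p) (nCk*[k!*[n∸k]!]≡n! k≤n) ⟩
    vp! n                                  ∎
    where open ≡-Reasoning

  exceed+vp!+vp!≤vp! : ∀ F x y → exceed F x (x + y) + vp! x + vp! y ≤ vp! (x + y)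
  exceed+vp!+vp!≤vp! zero x y = begin
    vp! x + vp! y                                 ≡⟨ cong (λ z → vp! x + vp! z) (m+n∸m≡n x y) ⟨
    vp! x + vp! (x + y ∸ x)                       ≤⟨ m≤n+m _ (vp p ((x + y) C x)) ⟩
    vp p ((x + y) C x) + (vp! x + vp! (x + y ∸ x)) ≡⟨ vp-nCk+vp!k+vp![n∸k]≡vp!n (m≤m+n x y) ⟩
    vp! (x + y)                                   ∎
    where open ≤-Reasoning
  exceed+vp!+vp!≤vp! (suc F) x y with +-carry x y
  ... | inj₁ (x₀≤[x+y]₀ , [x+y]/p≡) = begin
    exceed (suc F) x (x + y) + vp! x + vp! y       ≡⟨ cong (λ e → e + vp! x + vp! y) (exceed-no F x (x + y) (≤⇒≯ x₀≤[x+y]₀)) ⟩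
    exceed F x′ ((x + y) / p) + vp! x + vp! y      ≡⟨ cong (λ z → exceed F x′ z + vp! x + vp! y) [x+y]/p≡ ⟩
    e + vp! x + vp! y                              ≡⟨ cong₂ (λ a b → e + a + b) (legendre x) (legendre y) ⟩
    e + (x′ + vp! x′) + (y′ + vp! y′)              ≡⟨ regroup e x′ (vp! x′) y′ (vp! y′) ⟩
    (x′ + y′) + (e + vp! x′ + vp! y′)              ≤⟨ +-monoʳ-≤ (x′ + y′) (exceed+vp!+vp!≤vp! F x′ y′) ⟩
    (x′ + y′) + vp! (x′ + y′)                      ≡⟨ cong (λ z → z + vp! z) [x+y]/p≡ ⟨
    (x + y) / p + vp! ((x + y) / p)                ≡⟨ legendre (x + y) ⟨
    vp! (x + y)                                    ∎
    where
    open ≤-Reasoning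
    x′ = x / p
    y′ = y / p
    e = exceed F x′ (x′ + y′)
    regroup : ∀ e a b c d → e + (a + b) + (c + d) ≡ (a + c) + (e + b + d)
    regroup = solve-∀
  ... | inj₂ ([x+y]₀<x₀ , [x+y]/p≡) = begin
    exceed (suc F) x (x + y) + vp! x + vp! y       ≡⟨ cong (λ e → e + vp! x + vp! y) (exceed-yes F x (x + y) [x+y]₀<x₀) ⟩
    suc (exceed F x′ ((x + y) / p)) + vp! x + vp! y ≡⟨ cong (λ z → suc (exceed F x′ z) + vp! x + vp! y) (trans [x+y]/p≡ (sym (+-suc x′ y′))) ⟩
    suc e + vp! x + vp! y                          ≡⟨ cong₂ (λ a b → suc e + a + b) (legendre x) (legendre y) ⟩
    suc e + (x′ + vp! x′) + (y′ + vp! y′)          ≤⟨ +-monoʳ-≤ (suc e + (x′ + vp! x′)) (+-monoʳ-≤ y′ (vp!≤vp!-suc y′)) ⟩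
    suc e + (x′ + vp! x′) + (y′ + vp! (suc y′))    ≡⟨ regroup e x′ (vp! x′) y′ (vp! (suc y′)) ⟩
    suc (x′ + y′) + (e + vp! x′ + vp! (suc y′))    ≤⟨ +-monoʳ-≤ (suc (x′ + y′)) (exceed+vp!+vp!≤vp! F x′ (suc y′)) ⟩
    suc (x′ + y′) + vp! (x′ + suc y′)              ≡⟨ cong (λ z → suc (x′ + y′) + vp! z) (+-suc x′ y′) ⟩
    suc (x′ + y′) + vp! (suc (x′ + y′))            ≡⟨ cong (λ z → z + vp! z) [x+y]/p≡ ⟨
    (x + y) / p + vp! ((x + y) / p)                ≡⟨ legendre (x + y) ⟨
    vp! (x + y)                                    ∎
    where
    open ≤-Reasoning
    x′ = x / p
    y′ = y / p
    e = exceed F x′ (x′ + suc y′)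
    regroup : ∀ e a b c d → suc e + (a + b) + (c + d) ≡ suc (a + c) + (e + b + d)
    regroup = solve-∀

  exceed≤vp-nCk : ∀ F {n k} → k ≤ n → exceed F k n ≤ vp p (n C k)
  exceed≤vp-nCk F {n} {k} k≤n = +-cancelʳ-≤ (vp! k + vp! (n ∸ k)) _ _ (begin
    exceed F k n + (vp! k + vp! (n ∸ k))           ≡⟨ +-assoc (exceed F k n) _ _ ⟨
    exceed F k n + vp! k + vp! (n ∸ k)             ≡⟨ cong (λ z → exceed F k z + vp! k + vp! (n ∸ k)) (m+[n∸m]≡n k≤n) ⟨
    exceed F k (k + (n ∸ k)) + vp! k + vp! (n ∸ k) ≤⟨ exceed+vp!+vp!≤vp! F k (n ∸ k) ⟩
    vp! (k + (n ∸ k))                              ≡⟨ cong vp! (m+[n∸m]≡n k≤n) ⟩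
    vp! n                                          ≡⟨ vp-nCk+vp!k+vp![n∸k]≡vp!n k≤n ⟨
    vp p (n C k) + (vp! k + vp! (n ∸ k))           ∎)
    where open ≤-Reasoning

  exceed+vp!≤vp! : ∀ F {x z} → x ≤ z → exceed F x z + vp! x ≤ vp! z
  exceed+vp!≤vp! F {x} {z} x≤z = begin
    exceed F x z + vp! x                           ≡⟨ cong (λ w → exceed F x w + vp! x) (m+[n∸m]≡n x≤z) ⟨
    exceed F x (x + (z ∸ x)) + vp! x               ≤⟨ m≤m+n _ (vp! (z ∸ x)) ⟩
    exceed F x (x + (z ∸ x)) + vp! x + vp! (z ∸ x) ≤⟨ exceed+vp!+vp!≤vp! F x (z ∸ x) ⟩
    vp! (x + (z ∸ x))                              ≡⟨ cong vp! (m+[n∸m]≡n x≤z) ⟩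
    vp! z                                          ∎
    where open ≤-Reasoning

  D≤vp-C : ∀ m n → n / p ≤ m → D p m n ≤ vp p (m C (m ∸ n / p))
  D≤vp-C m n n/p≤m = begin
    D p m n                   ≡⟨ D≡exceed m n ⟩
    exceed n (n / p) m        ≤⟨ exceed≤vp-nCk n n/p≤m ⟩
    vp p (m C (n / p))        ≡⟨ cong (vp p) (nCk≡nC[n∸k] n/p≤m) ⟩
    vp p (m C (m ∸ n / p))    ∎
    where open ≤-Reasoning

  module _ {m s t : ℕ} (s≤m : s ≤ m) (t≤m : t ≤ m) (m≤s+t : m ≤ s + t) where

    private
      a = m ∸ s
      a≤t : a ≤ t
      a≤t = m≤n+o⇒m∸n≤o m s m≤s+t

    vp-multinomial≡ : vp p (multinomial m (m ∸ s) (m ∸ t) (s + t ∸ m)) ≡ vp p (m C t) + vp p (t C (m ∸ s))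
    vp-multinomial≡ = begin
      vp p (multinomial m a (m ∸ t) (s + t ∸ m))  ≡⟨ cong (vp p ∘ multinomial m a (m ∸ t)) s+t∸m≡t∸a ⟩
      vp p (multinomial m a (m ∸ t) (t ∸ a))      ≡⟨ cong (vp p) (multinomial≡nCk*kCj t≤m a≤t) ⟩
      vp p ((m C t) * (t C a))                    ≡⟨ vp-* (m C t) (t C a) {{>-nonZero (0<nCk t≤m)}} {{>-nonZero (0<nCk a≤t)}} ⟩
      vp p (m C t) + vp p (t C a)                 ∎
      where
      open ≡-Reasoning
      s+t∸m≡t∸a : s + t ∸ m ≡ t ∸ a
      s+t∸m≡t∸a = trans (cong (s + t ∸_) (sym (m+[n∸m]≡n s≤m))) ([m+n]∸[m+o]≡n∸o s t a)

    D≤exceed+vp-multinomial : ∀ n →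
      D p m n ≤ exceed n (n / p) (m ∸ s) + vp p (multinomial m (m ∸ s) (m ∸ t) (s + t ∸ m))
    D≤exceed+vp-multinomial n = begin
      D p m n                                            ≡⟨ D≡exceed m n ⟩
      exceed n q m                                       ≤⟨ exceed-triangle n q a m ⟩
      exceed n q a + exceed n a m                        ≤⟨ +-monoʳ-≤ (exceed n q a) (exceed-triangle n a t m) ⟩
      exceed n q a + (exceed n a t + exceed n t m)       ≤⟨ +-monoʳ-≤ (exceed n q a) (+-mono-≤ (exceed≤vp-nCk n a≤t) (exceed≤vp-nCk n t≤m)) ⟩
      exceed n q a + (vp p (t C a) + vp p (m C t))       ≡⟨ cong (exceed n q a +_) (trans (+-comm (vp p (t C a)) (vp p (m C t))) (sym vp-multinomial≡)) ⟩
      exceed n q a + vp p (multinomial m a (m ∸ t) (s + t ∸ m)) ∎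
      where
      open ≤-Reasoning
      q = n / p

    D+m≤s+n/p+vp-multinomial : ∀ n → m ∸ s ≤ n / p →
      D p m n + m ≤ s + n / p + vp p (multinomial m (m ∸ s) (m ∸ t) (s + t ∸ m))
    D+m≤s+n/p+vp-multinomial n a≤q = begin
      D p m n + m                        ≤⟨ +-monoˡ-≤ m (D≤exceed+vp-multinomial n) ⟩
      exceed n q a + vm + m              ≡⟨ cong (exceed n q a + vm +_) (trans (sym (m+[n∸m]≡n s≤m)) (+-comm s a)) ⟩
      exceed n q a + vm + (a + s)        ≡⟨ regroup (exceed n q a) vm a s ⟩
      exceed n q a + a + (s + vm)        ≤⟨ +-monoˡ-≤ (s + vm) (exceed+y≤x n a≤q) ⟩
      q + (s + vm)                       ≡⟨ regroup′ q s vm ⟩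
      s + q + vm                         ∎
      where
      open ≤-Reasoning
      q = n / p
      vm = vp p (multinomial m a (m ∸ t) (s + t ∸ m))
      regroup : ∀ e v a s → e + v + (a + s) ≡ e + a + (s + v)
      regroup = solve-∀
      regroup′ : ∀ q s v → q + (s + v) ≡ s + q + v
      regroup′ = solve-∀

    D+m+vp!n≤s+n/p+t+vp!t+vp-multinomial : ∀ n → n / p ≤ m ∸ s →
      D p m n + (m + vp! n) ≤ s + n / p + t + vp! t + vp p (multinomial m (m ∸ s) (m ∸ t) (s + t ∸ m))
    D+m+vp!n≤s+n/p+t+vp!t+vp-multinomial n q≤a = begin
      D p m n + (m + vp! n)                ≤⟨ +-monoˡ-≤ (m + vp! n) (D≤exceed+vp-multinomial n) ⟩
      exceed n q a + vm + (m + vp! n)      ≡⟨ cong (λ z → exceed n q a + vm + (m + z)) (legendre n) ⟩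
      exceed n q a + vm + (m + (q + vp! q)) ≡⟨ regroup (exceed n q a) vm m q (vp! q) ⟩
      (exceed n q a + vp! q) + vm + m + q  ≤⟨ +-monoˡ-≤ q (+-mono-≤ (+-monoˡ-≤ vm exceed+vp!q≤vp!t) m≤s+t) ⟩
      vp! t + vm + (s + t) + q             ≡⟨ regroup′ (vp! t) vm s t q ⟩
      s + q + t + vp! t + vm               ∎
      where
      open ≤-Reasoning
      q = n / p
      vm = vp p (multinomial m a (m ∸ t) (s + t ∸ m))
      exceed+vp!q≤vp!t : exceed n q a + vp! q ≤ vp! t
      exceed+vp!q≤vp!t = ≤-trans (exceed+vp!≤vp! n q≤a) (vp!-mono-≤ a≤t)
      regroup : ∀ e v m q w → e + v + (m + (q + w)) ≡ e + w + v + m + q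
      regroup = solve-∀
      regroup′ : ∀ w v s t q → w + v + (s + t) + q ≡ s + q + t + w + v
      regroup′ = solve-∀

module IntegerBound (p-2 : ℕ) (p-prime : Prime (suc (suc p-2))) where
  import Data.Nat as Nat
  open Nat using (_∸_)
  import Data.Nat.Properties as ℕP
  open import Data.Integer
  open import Data.Integer.Properties
  open import Data.Integer.Tactic.RingSolver using (solve-∀)
  open import Relation.Binary.PropositionalEquality
  open import Relation.Nullary using (Dec; yes; no)
  open Digits p-2 using (p)
  open Valuation p-2 p-prime

  +a≤+c-+b : ∀ {a b c} → a Nat.+ b Nat.≤ c → + a ≤ + c - + b
  +a≤+c-+b {a} {b} {c} a+b≤c = begin
    + a                     ≡⟨ cancel (+ a) (+ b) ⟨
    + a + + b - + b         ≡⟨ cong (_- + b) (pos-+ a b) ⟨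
    + (a Nat.+ b) - + b     ≤⟨ +-monoˡ-≤ (- + b) (+≤+ a+b≤c) ⟩
    + c - + b               ∎
    where
    open ≤-Reasoning
    cancel : ∀ a b → a + b - b ≡ a
    cancel = solve-∀

  D≤vp-multinomial-bound : ∀ m n s t → s Nat.⊔ t Nat.≤ m → m Nat.≤ s Nat.+ t →
    + D p m n ≤ + s - + m + + (n div p) + ((+ t + vpFactQuot p t n) ⊔ + 0)
                + + vp p (multinomial m (m ∸ s) (m ∸ t) (s Nat.+ t ∸ m))
  D≤vp-multinomial-bound m n s t s⊔t≤m m≤s+t = by-cases (m ∸ s Nat.≤? q)
    where
    q = n div p
    vm = vp p (multinomial m (m ∸ s) (m ∸ t) (s Nat.+ t ∸ m))
    s≤m = ℕP.≤-trans (ℕP.m≤m⊔n s t) s⊔t≤m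
    t≤m = ℕP.≤-trans (ℕP.m≤n⊔m s t) s⊔t≤m
    open ≤-Reasoning
    by-cases : Dec (m ∸ s Nat.≤ q) → + D p m n ≤ + s - + m + + q + ((+ t + vpFactQuot p t n) ⊔ + 0) + + vm
    by-cases (yes a≤q) = begin
      + D p m n                                          ≤⟨ +a≤+c-+b (D+m≤s+n/p+vp-multinomial s≤m t≤m m≤s+t n a≤q) ⟩
      + (s Nat.+ q Nat.+ vm) - + m                       ≡⟨ cong (_- + m) (trans (pos-+ (s Nat.+ q) vm) (cong (_+ + vm) (pos-+ s q))) ⟩
      + s + + q + + vm - + m                             ≡⟨ regroup (+ s) (+ m) (+ q) (+ vm) ⟩
      + s - + m + + q + + 0 + + vm                       ≤⟨ +-monoˡ-≤ (+ vm) (+-monoʳ-≤ (+ s - + m + + q) (i≤j⊔i _ (+ 0))) ⟩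
      + s - + m + + q + ((+ t + vpFactQuot p t n) ⊔ + 0) + + vm ∎
      where
      regroup : ∀ s m q v → s + q + v - m ≡ s - m + q + + 0 + v
      regroup = solve-∀
    by-cases (no a≰q) = begin
      + D p m n                                          ≤⟨ +a≤+c-+b (D+m+vp!n≤s+n/p+t+vp!t+vp-multinomial s≤m t≤m m≤s+t n q≤a) ⟩
      + (s Nat.+ q Nat.+ t Nat.+ vp! t Nat.+ vm) - + (m Nat.+ vp! n)
        ≡⟨ cong₂ _-_ (trans (pos-+ _ vm) (cong (_+ + vm) (trans (pos-+ _ (vp! t)) (cong (_+ + vp! t)
                       (trans (pos-+ _ t) (cong (_+ + t) (pos-+ s q)))))))
                     (pos-+ m (vp! n)) ⟩
      + s + + q + + t + + vp! t + + vm - (+ m + + vp! n) ≡⟨ regroup (+ s) (+ m) (+ q) (+ t) (+ vp! t) (+ vp! n) (+ vm) ⟩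
      + s - + m + + q + (+ t + vpFactQuot p t n) + + vm  ≤⟨ +-monoˡ-≤ (+ vm) (+-monoʳ-≤ (+ s - + m + + q) (i≤i⊔j _ (+ 0))) ⟩
      + s - + m + + q + ((+ t + vpFactQuot p t n) ⊔ + 0) + + vm ∎
      where
      q≤a : n div p Nat.≤ m ∸ s
      q≤a = ℕP.≰⇒≥ a≰q
      regroup : ∀ s m q t w v u → s + q + t + w + u - (m + v) ≡ s - m + q + (t + (w - v)) + u
      regroup = solve-∀

module BinomialProduct where
  import Data.Nat as Nat
  open Nat using (zero; _∸_; _!; NonZero)
  import Data.Nat.Properties as ℕP
  open ℕP using (_!≢0)
  open import Data.Nat.Combinatorics using (_C_; nCk+nC[k+1]≡[n+1]C[k+1]; k>n⇒nCk≡0)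
  open import Data.Nat.Combinatorics.Base using (_P′_)
  import Data.Integer as ℤ
  open ℤ using (+_)
  import Data.Integer.Properties as ℤP
  open import Data.Integer.Tactic.RingSolver using (solve-∀)
  open import Data.Rational using (ℚ; 0ℚ; 1ℚ; _+_; _*_; _-_; _/_; fromℚᵘ)
  import Data.Rational.Properties as ℚP
  open import Data.Rational.Unnormalised as ℚᵘ using (ℚᵘ; mkℚᵘ; *≡*)
  import Data.Rational.Unnormalised.Properties as ℚᵘP
  open import Data.Rational.Solver using (module +-*-Solver)
  open +-*-Solver using (solve; _:+_; _:*_; _:-_; _:=_; con)
  open import Data.List using (map; applyUpTo)
  open import Data.Sum using (_⊎_; inj₁; inj₂)
  open import Function using (_∘_)
  open import Relation.Binary.PropositionalEquality
  open ≡-Reasoning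
  open Factorials

  fromℚᵘ-+ : ∀ x y → fromℚᵘ (x ℚᵘ.+ y) ≡ fromℚᵘ x + fromℚᵘ y
  fromℚᵘ-+ x y = ℚP.toℚᵘ-injective (ℚᵘP.≃-trans (ℚP.toℚᵘ-fromℚᵘ _) (ℚᵘP.≃-sym (ℚᵘP.≃-trans
    (ℚP.toℚᵘ-homo-+ (fromℚᵘ x) (fromℚᵘ y)) (ℚᵘP.+-cong (ℚP.toℚᵘ-fromℚᵘ x) (ℚP.toℚᵘ-fromℚᵘ y)))))

  fromℚᵘ-* : ∀ x y → fromℚᵘ (x ℚᵘ.* y) ≡ fromℚᵘ x * fromℚᵘ y
  fromℚᵘ-* x y = ℚP.toℚᵘ-injective (ℚᵘP.≃-trans (ℚP.toℚᵘ-fromℚᵘ _) (ℚᵘP.≃-sym (ℚᵘP.≃-trans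
    (ℚP.toℚᵘ-homo-* (fromℚᵘ x) (fromℚᵘ y)) (ℚᵘP.*-cong (ℚP.toℚᵘ-fromℚᵘ x) (ℚP.toℚᵘ-fromℚᵘ y)))))

  toℚ : ℕ → ℚ
  toℚ n = + n / 1

  toℚ-+ : ∀ a b → toℚ (a Nat.+ b) ≡ toℚ a + toℚ b
  toℚ-+ a b = trans (ℚP.fromℚᵘ-cong {mkℚᵘ (+ (a Nat.+ b)) 0} {mkℚᵘ (+ a) 0 ℚᵘ.+ mkℚᵘ (+ b) 0} (*≡* cross))
                    (fromℚᵘ-+ (mkℚᵘ (+ a) 0) (mkℚᵘ (+ b) 0))
    where
    cross : + (a Nat.+ b) ℤ.* + 1 ≡ (+ a ℤ.* + 1 ℤ.+ + b ℤ.* + 1) ℤ.* + 1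
    cross = trans (cong (ℤ._* + 1) (ℤP.pos-+ a b)) (clear-denominators (+ a) (+ b))
      where
      clear-denominators : ∀ (x y : ℤ.ℤ) → (x ℤ.+ y) ℤ.* + 1 ≡ (x ℤ.* + 1 ℤ.+ y ℤ.* + 1) ℤ.* + 1
      clear-denominators = solve-∀

  toℚ-* : ∀ a b → toℚ (a Nat.* b) ≡ toℚ a * toℚ b
  toℚ-* a b = trans (ℚP.fromℚᵘ-cong {mkℚᵘ (+ (a Nat.* b)) 0} {mkℚᵘ (+ a) 0 ℚᵘ.* mkℚᵘ (+ b) 0} (*≡* (cong (ℤ._* + 1) (ℤP.pos-* a b))))
                    (fromℚᵘ-* (mkℚᵘ (+ a) 0) (mkℚᵘ (+ b) 0))

  toℚ-∸ : ∀ {a b} → b Nat.≤ a → toℚ (a ∸ b) ≡ toℚ a - toℚ b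
  toℚ-∸ {a} {b} b≤a = begin
    toℚ (a ∸ b)                  ≡⟨ add-sub (toℚ (a ∸ b)) (toℚ b) ⟩
    toℚ (a ∸ b) + toℚ b - toℚ b  ≡⟨ cong (_- toℚ b) (toℚ-+ (a ∸ b) b) ⟨
    toℚ (a ∸ b Nat.+ b) - toℚ b  ≡⟨ cong (λ x → toℚ x - toℚ b) (ℕP.m∸n+n≡m b≤a) ⟩
    toℚ a - toℚ b                ∎
    where
    add-sub : ∀ x y → x ≡ x + y - y
    add-sub = solve 2 (λ x y → x := x :+ y :- y) refl

  1/n*toℚn≡1 : ∀ n .{{_ : NonZero n}} → (+ 1 / n) * toℚ n ≡ 1ℚ
  1/n*toℚn≡1 n@(Nat.suc n-1) =
    trans (sym (fromℚᵘ-* (mkℚᵘ (+ 1) n-1) (mkℚᵘ (+ n) 0)))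
          (ℚP.fromℚᵘ-cong {mkℚᵘ (+ 1) n-1 ℚᵘ.* mkℚᵘ (+ n) 0} {ℚᵘ.1ℚᵘ} (*≡* cross))
    where
    cross : (+ 1 ℤ.* + n) ℤ.* + 1 ≡ + 1 ℤ.* + (n Nat.* 1)
    cross = trans (ℤP.*-identityʳ _) (cong (λ w → + 1 ℤ.* + w) (sym (ℕP.*-identityʳ n)))

  ∑ : ℕ → (ℕ → ℚ) → ℚ
  ∑ zero    f = 0ℚ
  ∑ (suc n) f = f 0 + ∑ n (f ∘ suc)

  ∑-cong : ∀ n {f g} → (∀ k → k Nat.< n → f k ≡ g k) → ∑ n f ≡ ∑ n g
  ∑-cong zero    f≡g = refl
  ∑-cong (suc n) f≡g = cong₂ _+_ (f≡g 0 Nat.z<s) (∑-cong n (λ k k<n → f≡g (suc k) (Nat.s<s k<n)))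

  ∑-zero : ∀ n {f} → (∀ k → k Nat.< n → f k ≡ 0ℚ) → ∑ n f ≡ 0ℚ
  ∑-zero zero    f≡0 = refl
  ∑-zero (suc n) f≡0 = trans (cong₂ _+_ (f≡0 0 Nat.z<s) (∑-zero n (λ k k<n → f≡0 (suc k) (Nat.s<s k<n)))) (ℚP.+-identityˡ 0ℚ)

  ∑-+ : ∀ n f g → ∑ n (λ k → f k + g k) ≡ ∑ n f + ∑ n g
  ∑-+ zero    f g = refl
  ∑-+ (suc n) f g = trans (cong (_+_ (f 0 + g 0)) (∑-+ n (f ∘ suc) (g ∘ suc))) (interchange (f 0) (g 0) _ _)
    where
    interchange : ∀ a b c d → a + b + (c + d) ≡ a + c + (b + d)
    interchange = solve 4 (λ a b c d → a :+ b :+ (c :+ d) := a :+ c :+ (b :+ d)) refl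

  *-∑ : ∀ n f c → c * ∑ n f ≡ ∑ n (λ k → c * f k)
  *-∑ zero    f c = ℚP.*-zeroʳ c
  *-∑ (suc n) f c = trans (ℚP.*-distribˡ-+ c (f 0) _) (cong (_+_ (c * f 0)) (*-∑ n (f ∘ suc) c))

  ∑-* : ∀ n f c → ∑ n f * c ≡ ∑ n (λ k → f k * c)
  ∑-* zero    f c = ℚP.*-zeroˡ c
  ∑-* (suc n) f c = trans (ℚP.*-distribʳ-+ c (f 0) _) (cong (_+_ (f 0 * c)) (∑-* n (f ∘ suc) c))

  ∑-suc : ∀ n f → ∑ (suc n) f ≡ ∑ n f + f n
  ∑-suc zero    f = trans (ℚP.+-identityʳ (f 0)) (sym (ℚP.+-identityˡ (f 0)))
  ∑-suc (suc n) f = trans (cong (_+_ (f 0)) (∑-suc n (f ∘ suc))) (sym (ℚP.+-assoc (f 0) _ _))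

  ∑-split : ∀ a b f → ∑ (a Nat.+ b) f ≡ ∑ a f + ∑ b (λ k → f (a Nat.+ k))
  ∑-split zero    b f = sym (ℚP.+-identityˡ _)
  ∑-split (suc a) b f = trans (cong (_+_ (f 0)) (∑-split a b (f ∘ suc))) (sym (ℚP.+-assoc (f 0) _ _))

  sumℚ-map-applyUpTo : ∀ (g : ℕ → ℚ) h n → sumℚ (map g (applyUpTo h n)) ≡ ∑ n (g ∘ h)
  sumℚ-map-applyUpTo g h zero    = refl
  sumℚ-map-applyUpTo g h (suc n) = cong (_+_ (g (h 0))) (sumℚ-map-applyUpTo g (h ∘ suc) n)

  falling-toℚ : ∀ {m d} → d Nat.≤ m → falling (toℚ m) d ≡ toℚ (m P′ d)
  falling-toℚ {m} {zero}  _   = refl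
  falling-toℚ {m} {suc d} d<m = begin
    falling (toℚ m) d * (toℚ m - toℚ d) ≡⟨ cong₂ _*_ (falling-toℚ (ℕP.<⇒≤ d<m)) (sym (toℚ-∸ (ℕP.<⇒≤ d<m))) ⟩
    toℚ (m P′ d) * toℚ (m ∸ d)          ≡⟨ toℚ-* (m P′ d) (m ∸ d) ⟨
    toℚ ((m P′ d) Nat.* (m ∸ d))        ≡⟨ cong toℚ (ℕP.*-comm (m P′ d) (m ∸ d)) ⟩
    toℚ ((m ∸ d) Nat.* (m P′ d))        ∎

  falling-toℚ-zero : ∀ {m d} → m Nat.< d → falling (toℚ m) d ≡ 0ℚ
  falling-toℚ-zero {m} {suc d} (Nat.s≤s m≤d) with ℕP.m≤n⇒m<n∨m≡n m≤d
  ... | inj₁ m<d  = trans (cong (_* (toℚ m - toℚ d)) (falling-toℚ-zero m<d)) (ℚP.*-zeroˡ (toℚ m - toℚ d))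
  ... | inj₂ refl = trans (cong (falling (toℚ m) m *_) (ℚP.+-inverseʳ (toℚ m))) (ℚP.*-zeroʳ (falling (toℚ m) m))

  term : ℚ → ℕ → ℕ → ℕ → ℚ
  term z m n k = toℚ (n C k) * falling (toℚ m) (n ∸ k) * falling z (m Nat.+ k)

  falling*falling≡∑ : ∀ z m n → falling z m * falling z n ≡ ∑ (suc n) (term z m n)
  falling*falling≡∑ z m zero = begin
    falling z m * 1ℚ                      ≡⟨ ℚP.*-identityʳ _ ⟩
    falling z m                           ≡⟨ cong (falling z) (ℕP.+-identityʳ m) ⟨
    falling z (m Nat.+ 0)                 ≡⟨ ℚP.*-identityˡ _ ⟨
    1ℚ * 1ℚ * falling z (m Nat.+ 0)       ≡⟨ ℚP.+-identityʳ _ ⟨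
    ∑ 1 (term z m zero)                   ∎
  falling*falling≡∑ z m (suc n) = begin
    falling z m * (falling z n * (z - toℚ n))           ≡⟨ ℚP.*-assoc (falling z m) (falling z n) _ ⟨
    falling z m * falling z n * (z - toℚ n)             ≡⟨ cong (_* (z - toℚ n)) (falling*falling≡∑ z m n) ⟩
    ∑ (suc n) (term z m n) * (z - toℚ n)                ≡⟨ ∑-* (suc n) (term z m n) (z - toℚ n) ⟩
    ∑ (suc n) (λ k → term z m n k * (z - toℚ n))        ≡⟨ ∑-cong (suc n) (λ k k<1+n → split (ℕP.≤-pred k<1+n)) ⟩
    ∑ (suc n) (λ k → z-step k + m-step k)               ≡⟨ ∑-+ (suc n) z-step m-step ⟩
    ∑ (suc n) z-step + ∑ (suc n) m-step                 ≡⟨ cong (_+_ (∑ (suc n) z-step)) m-steps ⟩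
    ∑ (suc n) z-step + (m-step 0 + ∑ (suc n) (m-step ∘ suc)) ≡⟨ swap (∑ (suc n) z-step) (m-step 0) _ ⟩
    m-step 0 + (∑ (suc n) z-step + ∑ (suc n) (m-step ∘ suc)) ≡⟨ cong (_+_ (m-step 0)) (∑-+ (suc n) z-step (m-step ∘ suc)) ⟨
    m-step 0 + ∑ (suc n) (λ k → z-step k + m-step (suc k))  ≡⟨ cong (_+_ (m-step 0)) (∑-cong (suc n) (λ k _ → pascal k)) ⟨
    ∑ (suc (suc n)) (term z m (suc n))                  ∎
    -- The last step is definitional: n C 0 and suc n C 0 both compute to 1.
    where
    z-step m-step : ℕ → ℚ
    z-step k = toℚ (n C k) * falling (toℚ m) (n ∸ k) * falling z (m Nat.+ suc k)
    m-step k = toℚ (n C k) * falling (toℚ m) (suc n ∸ k) * falling z (m Nat.+ k)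

    -- z − n = (z − (m + k)) + (m − (n − k)): the first part raises (z)_{m+k}, the second (m)_{n−k}.
    split : ∀ {k} → k Nat.≤ n → term z m n k * (z - toℚ n) ≡ z-step k + m-step k
    split {k} k≤n = begin
      c * f * g * (z - toℚ n)                                        ≡⟨ regroup c f g z (toℚ m) (toℚ n) (toℚ k) ⟩
      c * f * (g * (z - (toℚ m + toℚ k))) + c * (f * (toℚ m - (toℚ n - toℚ k))) * g
        ≡⟨ cong₂ (λ x y → c * f * (g * (z - x)) + c * (f * (toℚ m - y)) * g) (toℚ-+ m k) (toℚ-∸ k≤n) ⟨
      c * f * (g * (z - toℚ (m Nat.+ k))) + c * (f * (toℚ m - toℚ (n ∸ k))) * g
        ≡⟨ cong₂ (λ x y → c * f * x + c * y * g)
             (cong (falling z) (ℕP.+-suc m k)) (cong (falling (toℚ m)) (ℕP.+-∸-assoc 1 k≤n)) ⟨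
      z-step k + m-step k                                            ∎
      where
      c = toℚ (n C k)
      f = falling (toℚ m) (n ∸ k)
      g = falling z (m Nat.+ k)
      regroup : ∀ c f g z m n k → c * f * g * (z - n) ≡ c * f * (g * (z - (m + k))) + c * (f * (m - (n - k))) * g
      regroup = solve 7 (λ c f g z m n k → c :* f :* g :* (z :- n)
                                        := c :* f :* (g :* (z :- (m :+ k))) :+ c :* (f :* (m :- (n :- k))) :* g) refl

    m-steps : ∑ (suc n) m-step ≡ m-step 0 + ∑ (suc n) (m-step ∘ suc)
    m-steps = begin
      ∑ (suc n) m-step                  ≡⟨ ℚP.+-identityʳ _ ⟨
      ∑ (suc n) m-step + 0ℚ             ≡⟨ cong (_+_ (∑ (suc n) m-step)) last-vanishes ⟨
      ∑ (suc n) m-step + m-step (suc n) ≡⟨ ∑-suc (suc n) m-step ⟨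
      ∑ (suc (suc n)) m-step            ∎
      where
      last-vanishes : m-step (suc n) ≡ 0ℚ
      last-vanishes = begin
        toℚ (n C suc n) * F * G   ≡⟨ cong (λ c → toℚ c * F * G) (k>n⇒nCk≡0 (ℕP.n<1+n n)) ⟩
        0ℚ * F * G                ≡⟨ cong (_* G) (ℚP.*-zeroˡ F) ⟩
        0ℚ * G                    ≡⟨ ℚP.*-zeroˡ G ⟩
        0ℚ                        ∎
        where
        F = falling (toℚ m) (n ∸ n)
        G = falling z (m Nat.+ suc n)

    pascal : ∀ k → term z m (suc n) (suc k) ≡ z-step k + m-step (suc k)
    pascal k = begin
      toℚ (suc n C suc k) * F * G                 ≡⟨ cong (λ c → toℚ c * F * G) (nCk+nC[k+1]≡[n+1]C[k+1] n k) ⟨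
      toℚ ((n C k) Nat.+ (n C suc k)) * F * G     ≡⟨ cong (λ c → c * F * G) (toℚ-+ (n C k) (n C suc k)) ⟩
      (toℚ (n C k) + toℚ (n C suc k)) * F * G     ≡⟨ distrib (toℚ (n C k)) (toℚ (n C suc k)) F G ⟩
      toℚ (n C k) * F * G + toℚ (n C suc k) * F * G ∎
      where
      F = falling (toℚ m) (n ∸ k)
      G = falling z (m Nat.+ suc k)
      distrib : ∀ a b f g → (a + b) * f * g ≡ a * f * g + b * f * g
      distrib = solve 4 (λ a b f g → (a :+ b) :* f :* g := a :* f :* g :+ b :* f :* g) refl

    swap : ∀ a b c → a + (b + c) ≡ b + (a + c)
    swap = solve 3 (λ a b c → a :+ (b :+ c) := b :+ (a :+ c)) refl

  cross-cancel : ∀ {x y u v a b} → u * a ≡ 1ℚ → v * b ≡ 1ℚ → x * b ≡ y * a → x * u ≡ y * v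
  cross-cancel {x} {y} {u} {v} {a} {b} ua≡1 vb≡1 xb≡ya = begin
    x * u               ≡⟨ ℚP.*-identityʳ (x * u) ⟨
    x * u * 1ℚ          ≡⟨ cong (x * u *_) vb≡1 ⟨
    x * u * (v * b)     ≡⟨ regroup x u v b ⟩
    x * b * (u * v)     ≡⟨ cong (_* (u * v)) xb≡ya ⟩
    y * a * (u * v)     ≡⟨ regroup′ y a u v ⟩
    y * v * (u * a)     ≡⟨ cong (y * v *_) ua≡1 ⟩
    y * v * 1ℚ          ≡⟨ ℚP.*-identityʳ (y * v) ⟩
    y * v               ∎
    where
    regroup : ∀ x u v b → x * u * (v * b) ≡ x * b * (u * v)
    regroup = solve 4 (λ x u v b → x :* u :* (v :* b) := x :* b :* (u :* v)) refl
    regroup′ : ∀ y a u v → y * a * (u * v) ≡ y * v * (u * a)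
    regroup′ = solve 4 (λ y a u v → y :* a :* (u :* v) := y :* v :* (u :* a)) refl

  1/[_]! : ℕ → ℚ
  1/[ n ]! = (+ 1 / n !) {{n !≢0}}

  1/[n]!*n!≡1 : ∀ n → 1/[ n ]! * toℚ (n !) ≡ 1ℚ
  1/[n]!*n!≡1 n = 1/n*toℚn≡1 (n !) {{n !≢0}}

  module _ (z : ℚ) (m n : ℕ) where

    scaled-term : ℕ → ℚ
    scaled-term k = 1/[ m ]! * 1/[ n ]! * term z m n k

    summand : ℕ → ℚ
    summand j = toℚ (multinomial j (j ∸ m) (j ∸ n) (m Nat.+ n ∸ j)) * binomQ z j

    binomQ*binomQ≡∑ : binomQ z m * binomQ z n ≡ ∑ (suc n) scaled-term
    binomQ*binomQ≡∑ = begin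
      falling z m * 1/[ m ]! * (falling z n * 1/[ n ]!)   ≡⟨ regroup (falling z m) 1/[ m ]! (falling z n) 1/[ n ]! ⟩
      1/[ m ]! * 1/[ n ]! * (falling z m * falling z n)   ≡⟨ cong (_*_ (1/[ m ]! * 1/[ n ]!)) (falling*falling≡∑ z m n) ⟩
      1/[ m ]! * 1/[ n ]! * ∑ (suc n) (term z m n)        ≡⟨ *-∑ (suc n) (term z m n) (1/[ m ]! * 1/[ n ]!) ⟩
      ∑ (suc n) scaled-term                               ∎
      where
      regroup : ∀ a b c d → a * b * (c * d) ≡ b * d * (a * c)
      regroup = solve 4 (λ a b c d → a :* b :* (c :* d) := b :* d :* (a :* c)) refl

    scaled-term≡summand : ∀ {k} → k Nat.≤ n → n ∸ k Nat.≤ m → scaled-term k ≡ summand (m Nat.+ k)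
    scaled-term≡summand {k} k≤n d≤m = begin
      1/[ m ]! * 1/[ n ]! * (c * f * g)                  ≡⟨ regroup 1/[ m ]! 1/[ n ]! c f g ⟩
      (c * f) * (1/[ m ]! * 1/[ n ]!) * g                ≡⟨ cong (_* g) (cross-cancel {c * f} {toℚ M} {1/[ m ]! * 1/[ n ]!} {1/[ j ]!} uv*m!n!≡1 (1/[n]!*n!≡1 j) cfj!≡M*m!n!) ⟩
      toℚ M * 1/[ j ]! * g                               ≡⟨ ℚP.*-assoc (toℚ M) 1/[ j ]! g ⟩
      toℚ M * (1/[ j ]! * g)                             ≡⟨ cong (toℚ M *_) (ℚP.*-comm 1/[ j ]! g) ⟩
      toℚ M * binomQ z j                                 ≡⟨ cong (λ x → toℚ x * binomQ z j) M≡ ⟩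
      summand j                                          ∎
      where
      j = m Nat.+ k
      d = n ∸ k
      M = multinomial j k (j ∸ n) d
      c = toℚ (n C k)
      f = falling (toℚ m) d
      g = falling z j
      M≡ : M ≡ multinomial j (j ∸ m) (j ∸ n) (m Nat.+ n ∸ j)
      M≡ = cong₂ (λ a b → multinomial j a (j ∸ n) b) (sym (ℕP.m+n∸m≡n m k)) (sym (ℕP.[m+n]∸[m+o]≡n∸o m n k))
      uv*m!n!≡1 : 1/[ m ]! * 1/[ n ]! * toℚ (m ! Nat.* n !) ≡ 1ℚ
      uv*m!n!≡1 = begin
        1/[ m ]! * 1/[ n ]! * toℚ (m ! Nat.* n !)               ≡⟨ cong (_*_ (1/[ m ]! * 1/[ n ]!)) (toℚ-* (m !) (n !)) ⟩
        1/[ m ]! * 1/[ n ]! * (toℚ (m !) * toℚ (n !))           ≡⟨ interchange 1/[ m ]! 1/[ n ]! (toℚ (m !)) (toℚ (n !)) ⟩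
        (1/[ m ]! * toℚ (m !)) * (1/[ n ]! * toℚ (n !))         ≡⟨ cong₂ _*_ (1/[n]!*n!≡1 m) (1/[n]!*n!≡1 n) ⟩
        1ℚ * 1ℚ                                                 ≡⟨ ℚP.*-identityˡ 1ℚ ⟩
        1ℚ                                                      ∎
        where
        interchange : ∀ a b c d → a * b * (c * d) ≡ (a * c) * (b * d)
        interchange = solve 4 (λ a b c d → a :* b :* (c :* d) := (a :* c) :* (b :* d)) refl
      cfj!≡M*m!n! : c * f * toℚ (j !) ≡ toℚ M * toℚ (m ! Nat.* n !)
      cfj!≡M*m!n! = begin
        c * f * toℚ (j !)                                 ≡⟨ cong (λ x → c * x * toℚ (j !)) (falling-toℚ d≤m) ⟩
        toℚ (n C k) * toℚ (m P′ d) * toℚ (j !)            ≡⟨ cong (_* toℚ (j !)) (toℚ-* (n C k) (m P′ d)) ⟨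
        toℚ ((n C k) Nat.* (m P′ d)) * toℚ (j !)          ≡⟨ toℚ-* ((n C k) Nat.* (m P′ d)) (j !) ⟨
        toℚ ((n C k) Nat.* (m P′ d) Nat.* j !)            ≡⟨ cong toℚ (nCk*mP′[n∸k]*[m+k]!≡multinomial*[m!*n!] k≤n d≤m) ⟩
        toℚ (M Nat.* (m ! Nat.* n !))                     ≡⟨ toℚ-* M (m ! Nat.* n !) ⟩
        toℚ M * toℚ (m ! Nat.* n !)                       ∎
      regroup : ∀ a b c f g → a * b * (c * f * g) ≡ (c * f) * (a * b) * g
      regroup = solve 5 (λ a b c f g → a :* b :* (c :* f :* g) := (c :* f) :* (a :* b) :* g) refl

    scaled-term≡0 : ∀ {k} → m Nat.< n ∸ k → scaled-term k ≡ 0ℚ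
    scaled-term≡0 {k} m<d = begin
      1/[ m ]! * 1/[ n ]! * (toℚ (n C k) * falling (toℚ m) (n ∸ k) * g)
        ≡⟨ cong (λ x → 1/[ m ]! * 1/[ n ]! * (toℚ (n C k) * x * g)) (falling-toℚ-zero m<d) ⟩
      1/[ m ]! * 1/[ n ]! * (toℚ (n C k) * 0ℚ * g)
        ≡⟨ annihilate 1/[ m ]! 1/[ n ]! (toℚ (n C k)) g ⟩
      0ℚ ∎
      where
      g = falling z (m Nat.+ k)
      annihilate : ∀ a b c g → a * b * (c * 0ℚ * g) ≡ 0ℚ
      annihilate = solve 4 (λ a b c g → a :* b :* (c :* con 0ℚ :* g) := con 0ℚ) refl

    shifted-sum : ℕ → ℚ
    shifted-sum b = ∑ (suc (m Nat.+ n) ∸ b) (λ i → summand (b Nat.+ i))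

    ∑-scaled-term≡shifted-sum : ∑ (suc n) scaled-term ≡ shifted-sum (m Nat.⊔ n)
    ∑-scaled-term≡shifted-sum = by-cases (ℕP.≤-total n m)
      where
      by-cases : n Nat.≤ m ⊎ m Nat.≤ n → ∑ (suc n) scaled-term ≡ shifted-sum (m Nat.⊔ n)
      by-cases (inj₁ n≤m) = begin
        ∑ (suc n) scaled-term                     ≡⟨ ∑-cong (suc n) (λ k k<1+n → scaled-term≡summand (ℕP.≤-pred k<1+n) (ℕP.≤-trans (ℕP.m∸n≤m n k) n≤m)) ⟩
        ∑ (suc n) (λ k → summand (m Nat.+ k))     ≡⟨ cong (λ N → ∑ N (λ k → summand (m Nat.+ k))) count ⟨
        shifted-sum m                             ≡⟨ cong shifted-sum (ℕP.m≥n⇒m⊔n≡m n≤m) ⟨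
        shifted-sum (m Nat.⊔ n)                   ∎
        where
        count : suc (m Nat.+ n) ∸ m ≡ suc n
        count = trans (ℕP.+-∸-assoc 1 (ℕP.m≤m+n m n)) (cong suc (ℕP.m+n∸m≡n m n))
      by-cases (inj₂ m≤n) = begin
        ∑ (suc n) scaled-term                                        ≡⟨ cong (λ N → ∑ N scaled-term) 1+n≡a+[1+m] ⟩
        ∑ (a Nat.+ suc m) scaled-term                                ≡⟨ ∑-split a (suc m) scaled-term ⟩
        ∑ a scaled-term + ∑ (suc m) (λ i → scaled-term (a Nat.+ i))  ≡⟨ cong (_+ ∑ (suc m) (λ i → scaled-term (a Nat.+ i))) (∑-zero a vanishing) ⟩
        0ℚ + ∑ (suc m) (λ i → scaled-term (a Nat.+ i))               ≡⟨ ℚP.+-identityˡ (∑ (suc m) (λ i → scaled-term (a Nat.+ i))) ⟩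
        ∑ (suc m) (λ i → scaled-term (a Nat.+ i))                    ≡⟨ ∑-cong (suc m) (λ i i<1+m → matching (ℕP.≤-pred i<1+m)) ⟩
        ∑ (suc m) (λ i → summand (n Nat.+ i))                        ≡⟨ cong (λ N → ∑ N (λ i → summand (n Nat.+ i))) (ℕP.m+n∸n≡m (suc m) n) ⟨
        shifted-sum n                                                ≡⟨ cong shifted-sum (ℕP.m≤n⇒m⊔n≡n m≤n) ⟨
        shifted-sum (m Nat.⊔ n)                                      ∎
        where
        a = n ∸ m
        n∸a≡m : n ∸ a ≡ m
        n∸a≡m = ℕP.m∸[m∸n]≡n m≤n
        1+n≡a+[1+m] : suc n ≡ a Nat.+ suc m
        1+n≡a+[1+m] = trans (cong suc (sym (ℕP.m∸n+n≡m m≤n))) (sym (ℕP.+-suc a m))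
        vanishing : ∀ k → k Nat.< a → scaled-term k ≡ 0ℚ
        vanishing k k<a = scaled-term≡0 {k} (subst (Nat._< n ∸ k) n∸a≡m (ℕP.∸-monoʳ-< k<a (ℕP.m∸n≤m n m)))
        matching : ∀ {i} → i Nat.≤ m → scaled-term (a Nat.+ i) ≡ summand (n Nat.+ i)
        matching {i} i≤m = trans
          (scaled-term≡summand (subst (a Nat.+ i Nat.≤_) (ℕP.m∸n+n≡m m≤n) (ℕP.+-monoʳ-≤ a i≤m))
                               (subst (n ∸ (a Nat.+ i) Nat.≤_) n∸a≡m (ℕP.∸-monoʳ-≤ n (ℕP.m≤m+n a i))))
          (cong summand (trans (sym (ℕP.+-assoc m a i)) (cong (Nat._+ i) (ℕP.m+[n∸m]≡n m≤n))))

    binomQ*binomQ≡sumℚ : binomQ z m * binomQ z n ≡ sumℚ (map summand (range (m Nat.⊔ n) (m Nat.+ n)))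
    binomQ*binomQ≡sumℚ = begin
      binomQ z m * binomQ z n       ≡⟨ binomQ*binomQ≡∑ ⟩
      ∑ (suc n) scaled-term         ≡⟨ ∑-scaled-term≡shifted-sum ⟩
      shifted-sum (m Nat.⊔ n)       ≡⟨ sumℚ-map-applyUpTo summand (m Nat.⊔ n Nat.+_) (suc (m Nat.+ n) ∸ (m Nat.⊔ n)) ⟨
      sumℚ (map summand (range (m Nat.⊔ n) (m Nat.+ n))) ∎

open import Data.Nat using (ℕ; suc; _+_; _∸_; _≤_; _⊔_; _!)
open import Data.Nat.Primality using (Prime)
open import Data.Nat.Combinatorics using (_C_)
open import Data.List using (map)
open import Data.Product using (_×_; _,_)
open import Data.Integer as ℤ using (+_)
open import Data.Rational as ℚ using (ℚ)
open import Relation.Binary.PropositionalEquality using (_≡_)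
open import Data.Nat using (zero; s≤s)

lemmaA7 : (p : ℕ) → Prime p → 5 ≤ p → (m n : ℕ) →
    -- (1)
    (D p m n ≤ D p (suc m) n + 1
      × ((c : ℕ) → 1 ≤ c → c ≤ p → D p m (n + c) ≤ D p m n + 1))
    -- (2)
    × (n div p ≤ m → D p m n ≤ vp p (m C (m ∸ n div p)))
    -- (3)
    × ((z : ℚ) → binomQ z m ℚ.* binomQ z n
        ≡ sumℚ (map (λ j → ((+ multinomial j (j ∸ m) (j ∸ n) (m + n ∸ j)) ℚ./ 1) ℚ.* binomQ z j)
                    (range (m ⊔ n) (m + n))))
    -- (4)
    × ((s t : ℕ) → s ⊔ t ≤ m → m ≤ s + t →
        + D p m n ℤ.≤ (+ s) ℤ.- (+ m) ℤ.+ (+ (n div p))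
          ℤ.+ (((+ t) ℤ.+ vpFactQuot p t n) ℤ.⊔ (+ 0))
          ℤ.+ (+ vp p (multinomial m (m ∸ s) (m ∸ t) (s + t ∸ m))))
lemmaA7 zero            _       ()
lemmaA7 (suc zero)      _       (s≤s ())
lemmaA7 (suc (suc p-2)) p-prime _ m n =
    (D-suc-≤ m n , λ _ _ c≤p → D-+-≤ m n c≤p)
  , D≤vp-C m n
  , (λ z → binomQ*binomQ≡sumℚ z m n)
  , D≤vp-multinomial-bound m n
  where
  open Digits p-2 using (D-suc-≤; D-+-≤)
  open Valuation p-2 p-prime using (D≤vp-C)
  open IntegerBound p-2 p-prime using (D≤vp-multinomial-bound)
  open BinomialProduct using (binomQ*binomQ≡sumℚ)
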